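{- Let $\mathsf{IntQCL}=\mathsf{G3IntQC}+\{(id^*_q),(\neg_l),(\neg_r),(\supset^*_l),(\forall^*_r),(\forall^*_l),(\exists^*_r),(lift)\}$. Every labelled sequent derivable in $\mathsf{IntQCL}$ is derivable in $\mathsf{IntQCL}$ without any application of $(ref)$ or $(tra)$.
   Context: First-order formulas: $A::= p(x_1,\dots,x_n)\mid\bot\mid (A\vee A)\mid(A\wedge A)\mid(A\supset A)\mid \forall x A\mid\exists xA$ (0-ary predicates are propositional variables); $\neg A$ abbreviates $A\supset\bot$; bound variables are distinct from parameters $a,b,\dots$, which replace free variables. $A[a/x]$: substitution of $a$ for free $x$; $p(\vec{a})$ with $\vec{a}=a_0,\dots,a_n$ all its parameters; $\vec{a}\in D_w$ abbreviates $a_0\in D_w,\dots,a_n\in D_w$. Labelled sequents $\mathcal{R},\Gamma\Rightarrow\Delta$: $\mathcal{R}$ a multiset of relational atoms $w\le v$ and domain atoms $a\in D_w$, $\Gamma,\Delta$ multisets of labelled formulas $w:A$. $\mathsf{G3IntQC}$ rules: $(id_q)$: $\mathcal{R},w\le v,\vec{a}\in D_w,w:p(\vec{a}),\Gamma\Rightarrow\Delta,v:p(\vec{a})$ (its 0-ary case is the rule $(id)$); $(\bot_l)$: $\mathcal{R},w:\bot,\Gamma\Rightarrow\Delta$; $(\wedge_l)$: from $\mathcal{R},w:A,w:B,\Gamma\Rightarrow\Delta$ infer $\mathcal{R},w:A\wedge B,\Gamma\Rightarrow\Delta$; $(\wedge_r)$: from $\mathcal{R},\Gamma\Rightarrow\Delta,w:A$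 and $\mathcal{R},\Gamma\Rightarrow\Delta,w:B$ infer $\mathcal{R},\Gamma\Rightarrow\Delta,w:A\wedge B$; $(\vee_l)$: from $\mathcal{R},w:A,\Gamma\Rightarrow\Delta$ and $\mathcal{R},w:B,\Gamma\Rightarrow\Delta$ infer $\mathcal{R},w:A\vee B,\Gamma\Rightarrow\Delta$; $(\vee_r)$: from $\mathcal{R},\Gamma\Rightarrow\Delta,w:A,w:B$ infer $\mathcal{R},\Gamma\Rightarrow\Delta,w:A\vee B$; $(\supset_r)$: from $\mathcal{R},w\le v,v:A,\Gamma\Rightarrow\Delta,v:B$ infer $\mathcal{R},\Gamma\Rightarrow\Delta,w:A\supset B$, $v$ not in the conclusion; $(\supset_l)$: from $\mathcal{R},w\le v,w:A\supset B,\Gamma\Rightarrow\Delta,v:A$ and $\mathcal{R},w\le v,w:A\supset B,v:B,\Gamma\Rightarrow\Delta$ infer $\mathcal{R},w\le v,w:A\supset B,\Gamma\Rightarrow\Delta$; $(ref)$: from $\mathcal{R},w\le w,\Gamma\Rightarrow\Delta$ infer $\mathcal{R},\Gamma\Rightarrow\Delta$; $(tra)$: from $\mathcal{R},w\le v,v\le u,w\le u,\Gamma\Rightarrow\Delta$ infer $\mathcal{R},w\le v,v\le u,\Gamma\Rightarrow\Delta$; $(\forall_r)$: from $\mathcal{R},w\le v,a\in D_v,\Gamma\Rightarrow\Delta,v:A[a/x]$ infer $\mathcal{R},\Gamma\Rightarrow\Delta,w:\forall xA$, $a,v$ not in the conclusion; $(\exists_r)$: from $\mathcal{R},a\in D_w,\Gamma\Rightarrow\Delta,w:A[a/x],w:\exists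 xA$ infer $\mathcal{R},a\in D_w,\Gamma\Rightarrow\Delta,w:\exists xA$; $(\exists_l)$: from $\mathcal{R},a\in D_w,w:A[a/x],\Gamma\Rightarrow\Delta$ infer $\mathcal{R},w:\exists xA,\Gamma\Rightarrow\Delta$, $a$ not in the conclusion; $(\forall_l)$: from $\mathcal{R},w\le v,a\in D_v,v:A[a/x],w:\forall xA,\Gamma\Rightarrow\Delta$ infer $\mathcal{R},w\le v,a\in D_v,w:\forall xA,\Gamma\Rightarrow\Delta$; $(nd)$: from $\mathcal{R},w\le v,a\in D_w,a\in D_v,\Gamma\Rightarrow\Delta$ infer $\mathcal{R},w\le v,a\in D_w,\Gamma\Rightarrow\Delta$; $(cd)$: from $\mathcal{R},w\le v,a\in D_v,a\in D_w,\Gamma\Rightarrow\Delta$ infer $\mathcal{R},w\le v,a\in D_v,\Gamma\Rightarrow\Delta$. Additional rules: a (not necessarily directed) path from $v$ to $w$ in $\mathcal{R}$ exists iff $v=w$ or there are labels $v=z_0,\dots,z_k=w$ with $z_i\le z_{i+1}$ or $z_{i+1}\le z_i$ in $\mathcal{R}$ for each $i$. $(id^*_q)$: $\mathcal{R},a_0\in D_{v_0},\dots,a_n\in D_{v_n},w:p(\vec{a}),\Gamma\Rightarrow w:p(\vec{a}),\Delta$, $\vec{a}=a_0,\dots,a_n$, with a path from each $v_i$ to $w$ in $\mathcal{R}$; $(\neg_r)$: from $\mathcal{R},w\le v,v:A,\Gamma\Rightarrow\Delta$ infer $\mathcal{R},\Gamma\Rightarrow\Delta,w:\neg A$, $v$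 not in the conclusion; $(\neg_l)$: from $\mathcal{R},w:\neg A,\Gamma\Rightarrow\Delta,w:A$ infer $\mathcal{R},w:\neg A,\Gamma\Rightarrow\Delta$; $(\supset^*_l)$: from $\mathcal{R},w:A\supset B,\Gamma\Rightarrow\Delta,w:A$ and $\mathcal{R},w:A\supset B,w:B,\Gamma\Rightarrow\Delta$ infer $\mathcal{R},w:A\supset B,\Gamma\Rightarrow\Delta$; $(\forall^*_r)$: from $\mathcal{R},a\in D_w,\Gamma\Rightarrow w:A[a/x],\Delta$ infer $\mathcal{R},\Gamma\Rightarrow w:\forall xA,\Delta$, $a$ not in the conclusion; $(\forall^*_l)$: from $\mathcal{R},a\in D_v,w:A[a/x],w:\forall xA,\Gamma\Rightarrow\Delta$ infer $\mathcal{R},a\in D_v,w:\forall xA,\Gamma\Rightarrow\Delta$, provided a path from $v$ to $w$ in $\mathcal{R}$; $(\exists^*_r)$: from $\mathcal{R},a\in D_v,\Gamma\Rightarrow\Delta,w:A[a/x],w:\exists xA$ infer $\mathcal{R},a\in D_v,\Gamma\Rightarrow\Delta,w:\exists xA$, provided a path from $v$ to $w$ in $\mathcal{R}$; $(lift)$: from $\mathcal{R},w\le u,w:A,u:A,\Gamma\Rightarrow\Delta$ infer $\mathcal{R},w\le u,w:A,\Gamma\Rightarrow\Delta$. -}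

module Defs where

open import Data.Nat using (ℕ; _≟_)
open import Data.Bool using (Bool; true; false)
open import Data.List using (List; []; _∷_; _++_; map; concatMap)
open import Data.List.Membership.Propositional using (_∈_; _∉_)
open import Data.List.Relation.Unary.All using (All)
open import Data.List.Relation.Binary.Permutation.Propositional using (_↭_)
open import Data.Product using (_×_; _,_; ∃)
open import Relation.Nullary using (yes; no)
open import Relation.Binary.PropositionalEquality using (_≡_)

data Term : Set where
  var : ℕ → Term
  par : ℕ → Term

data Fm : Set where
  atom : ℕ → List Term → Fm
  ⊥'   : Fm
  _∨'_ : Fm → Fm → Fm
  _∧'_ : Fm → Fm → Fm
  _⊃_  : Fm → Fm → Fm
  ∀'   : ℕ → Fm → Fm
  ∃'   : ℕ → Fm → Fm

infixr 6 _∧'_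
infixr 5 _∨'_
infixr 4 _⊃_

¬' : Fm → Fm
¬' A = A ⊃ ⊥'

patom : ℕ → List ℕ → Fm
patom p as = atom p (map par as)

substT : ℕ → ℕ → Term → Term
substT x a (var y) with x ≟ y
... | yes _ = par a
... | no  _ = var y
substT x a (par b) = par b

_[_/_] : Fm → ℕ → ℕ → Fm
atom p ts [ a / x ] = atom p (map (substT x a) ts)
⊥'        [ a / x ] = ⊥'
(A ∨' B)  [ a / x ] = (A [ a / x ]) ∨' (B [ a / x ])
(A ∧' B)  [ a / x ] = (A [ a / x ]) ∧' (B [ a / x ])
(A ⊃ B)   [ a / x ] = (A [ a / x ]) ⊃ (B [ a / x ])
∀' y A    [ a / x ] with x ≟ y
... | yes _ = ∀' y A
... | no  _ = ∀' y (A [ a / x ])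
∃' y A    [ a / x ] with x ≟ y
... | yes _ = ∃' y A
... | no  _ = ∃' y (A [ a / x ])

data RAt : Set where
  _≼_  : ℕ → ℕ → RAt
  _∈D_ : ℕ → ℕ → RAt     -- domain atom a ∈ D_w  (parameter, label)

LF : Set
LF = ℕ × Fm

-- Multisets are represented by lists; the calculus includes closure
-- under permutation (multiset equality), see rule `perm` below.
infix 2 _∣_⇒_
record Seq : Set where
  constructor _∣_⇒_
  field
    rel : List RAt
    ant : List LF
    suc : List LF

parsT : Term → List ℕ
parsT (var _) = []
parsT (par a) = a ∷ []

parsF : Fm → List ℕ
parsF (atom _ ts) = concatMap parsT ts
parsF ⊥'         = []
parsF (A ∨' B)   = parsF A ++ parsF B
parsF (A ∧' B)   = parsF A ++ parsF B
parsF (A ⊃ B)    = parsF A ++ parsF B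
parsF (∀' _ A)   = parsF A
parsF (∃' _ A)   = parsF A

parsR : RAt → List ℕ
parsR (_ ≼ _)  = []
parsR (a ∈D _) = a ∷ []

labsR : RAt → List ℕ
labsR (w ≼ v)  = w ∷ v ∷ []
labsR (_ ∈D w) = w ∷ []

labsLF : LF → List ℕ
labsLF (w , _) = w ∷ []

parsLF : LF → List ℕ
parsLF (_ , A) = parsF A

params : Seq → List ℕ
params (R ∣ Γ ⇒ Δ) = concatMap parsR R ++ concatMap parsLF Γ ++ concatMap parsLF Δ

labels : Seq → List ℕ
labels (R ∣ Γ ⇒ Δ) = concatMap labsR R ++ concatMap labsLF Γ ++ concatMap labsLF Δ

data Path (R : List RAt) : ℕ → ℕ → Set where
  here : ∀ {v} → Path R v v
  fwd  : ∀ {v z w} → (v ≼ z) ∈ R → Path R z w → Path R v w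
  bwd  : ∀ {v z w} → (z ≼ v) ∈ R → Path R z w → Path R v w

-- The index rt : Bool says whether (ref) and (tra) may be used:
-- Der true s  = s derivable in IntQCL,
-- Der false s = s derivable in IntQCL without (ref)/(tra).
-- Principal formulas are written at the head of lists; the rule `perm`
-- identifies sequents equal as multisets.

data Der (rt : Bool) : Seq → Set where
  perm : ∀ {R R' Γ Γ' Δ Δ'} → R ↭ R' → Γ ↭ Γ' → Δ ↭ Δ' →
         Der rt (R ∣ Γ ⇒ Δ) → Der rt (R' ∣ Γ' ⇒ Δ')
  id-q : ∀ {R Γ Δ w v p as} → (w ≼ v) ∈ R → All (λ a → (a ∈D w) ∈ R) as →
         (w , patom p as) ∈ Γ → (v , patom p as) ∈ Δ → Der rt (R ∣ Γ ⇒ Δ)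
  ⊥l   : ∀ {R Γ Δ w} → (w , ⊥') ∈ Γ → Der rt (R ∣ Γ ⇒ Δ)
  ∧l   : ∀ {R Γ Δ w A B} → Der rt (R ∣ (w , A) ∷ (w , B) ∷ Γ ⇒ Δ) →
         Der rt (R ∣ (w , A ∧' B) ∷ Γ ⇒ Δ)
  ∧r   : ∀ {R Γ Δ w A B} → Der rt (R ∣ Γ ⇒ (w , A) ∷ Δ) → Der rt (R ∣ Γ ⇒ (w , B) ∷ Δ) →
         Der rt (R ∣ Γ ⇒ (w , A ∧' B) ∷ Δ)
  ∨l   : ∀ {R Γ Δ w A B} → Der rt (R ∣ (w , A) ∷ Γ ⇒ Δ) → Der rt (R ∣ (w , B) ∷ Γ ⇒ Δ) →
         Der rt (R ∣ (w , A ∨' B) ∷ Γ ⇒ Δ)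
  ∨r   : ∀ {R Γ Δ w A B} → Der rt (R ∣ Γ ⇒ (w , A) ∷ (w , B) ∷ Δ) →
         Der rt (R ∣ Γ ⇒ (w , A ∨' B) ∷ Δ)
  ⊃r   : ∀ {R Γ Δ w v A B} → v ∉ labels (R ∣ Γ ⇒ (w , A ⊃ B) ∷ Δ) →
         Der rt ((w ≼ v) ∷ R ∣ (v , A) ∷ Γ ⇒ (v , B) ∷ Δ) →
         Der rt (R ∣ Γ ⇒ (w , A ⊃ B) ∷ Δ)
  ⊃l   : ∀ {R Γ Δ w v A B} →
         Der rt ((w ≼ v) ∷ R ∣ (w , A ⊃ B) ∷ Γ ⇒ (v , A) ∷ Δ) →
         Der rt ((w ≼ v) ∷ R ∣ (v , B) ∷ (w , A ⊃ B) ∷ Γ ⇒ Δ) →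
         Der rt ((w ≼ v) ∷ R ∣ (w , A ⊃ B) ∷ Γ ⇒ Δ)
  ref  : ∀ {R Γ Δ w} → rt ≡ true → Der rt ((w ≼ w) ∷ R ∣ Γ ⇒ Δ) → Der rt (R ∣ Γ ⇒ Δ)
  tra  : ∀ {R Γ Δ w v u} → rt ≡ true →
         Der rt ((w ≼ u) ∷ (w ≼ v) ∷ (v ≼ u) ∷ R ∣ Γ ⇒ Δ) →
         Der rt ((w ≼ v) ∷ (v ≼ u) ∷ R ∣ Γ ⇒ Δ)
  ∀r   : ∀ {R Γ Δ w v a x A} →
         v ∉ labels (R ∣ Γ ⇒ (w , ∀' x A) ∷ Δ) → a ∉ params (R ∣ Γ ⇒ (w , ∀' x A) ∷ Δ) →
         Der rt ((w ≼ v) ∷ (a ∈D v) ∷ R ∣ Γ ⇒ (v , A [ a / x ]) ∷ Δ) →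
         Der rt (R ∣ Γ ⇒ (w , ∀' x A) ∷ Δ)
  ∃r   : ∀ {R Γ Δ w a x A} →
         Der rt ((a ∈D w) ∷ R ∣ Γ ⇒ (w , A [ a / x ]) ∷ (w , ∃' x A) ∷ Δ) →
         Der rt ((a ∈D w) ∷ R ∣ Γ ⇒ (w , ∃' x A) ∷ Δ)
  ∃l   : ∀ {R Γ Δ w a x A} → a ∉ params (R ∣ (w , ∃' x A) ∷ Γ ⇒ Δ) →
         Der rt ((a ∈D w) ∷ R ∣ (w , A [ a / x ]) ∷ Γ ⇒ Δ) →
         Der rt (R ∣ (w , ∃' x A) ∷ Γ ⇒ Δ)
  ∀l   : ∀ {R Γ Δ w v a x A} →
         Der rt ((w ≼ v) ∷ (a ∈D v) ∷ R ∣ (v , A [ a / x ]) ∷ (w , ∀' x A) ∷ Γ ⇒ Δ) →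
         Der rt ((w ≼ v) ∷ (a ∈D v) ∷ R ∣ (w , ∀' x A) ∷ Γ ⇒ Δ)
  nd   : ∀ {R Γ Δ w v a} →
         Der rt ((w ≼ v) ∷ (a ∈D w) ∷ (a ∈D v) ∷ R ∣ Γ ⇒ Δ) →
         Der rt ((w ≼ v) ∷ (a ∈D w) ∷ R ∣ Γ ⇒ Δ)
  cd   : ∀ {R Γ Δ w v a} →
         Der rt ((w ≼ v) ∷ (a ∈D v) ∷ (a ∈D w) ∷ R ∣ Γ ⇒ Δ) →
         Der rt ((w ≼ v) ∷ (a ∈D v) ∷ R ∣ Γ ⇒ Δ)
  id*q : ∀ {R Γ Δ w p as} →
         All (λ a → ∃ λ v → (a ∈D v) ∈ R × Path R v w) as →
         (w , patom p as) ∈ Γ → (w , patom p as) ∈ Δ → Der rt (R ∣ Γ ⇒ Δ)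
  ¬r   : ∀ {R Γ Δ w v A} → v ∉ labels (R ∣ Γ ⇒ (w , ¬' A) ∷ Δ) →
         Der rt ((w ≼ v) ∷ R ∣ (v , A) ∷ Γ ⇒ Δ) →
         Der rt (R ∣ Γ ⇒ (w , ¬' A) ∷ Δ)
  ¬l   : ∀ {R Γ Δ w A} → Der rt (R ∣ (w , ¬' A) ∷ Γ ⇒ (w , A) ∷ Δ) →
         Der rt (R ∣ (w , ¬' A) ∷ Γ ⇒ Δ)
  ⊃*l  : ∀ {R Γ Δ w A B} →
         Der rt (R ∣ (w , A ⊃ B) ∷ Γ ⇒ (w , A) ∷ Δ) →
         Der rt (R ∣ (w , B) ∷ (w , A ⊃ B) ∷ Γ ⇒ Δ) →
         Der rt (R ∣ (w , A ⊃ B) ∷ Γ ⇒ Δ)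
  ∀*r  : ∀ {R Γ Δ w a x A} → a ∉ params (R ∣ Γ ⇒ (w , ∀' x A) ∷ Δ) →
         Der rt ((a ∈D w) ∷ R ∣ Γ ⇒ (w , A [ a / x ]) ∷ Δ) →
         Der rt (R ∣ Γ ⇒ (w , ∀' x A) ∷ Δ)
  ∀*l  : ∀ {R Γ Δ w v a x A} → Path ((a ∈D v) ∷ R) v w →
         Der rt ((a ∈D v) ∷ R ∣ (w , A [ a / x ]) ∷ (w , ∀' x A) ∷ Γ ⇒ Δ) →
         Der rt ((a ∈D v) ∷ R ∣ (w , ∀' x A) ∷ Γ ⇒ Δ)
  ∃*r  : ∀ {R Γ Δ w v a x A} → Path ((a ∈D v) ∷ R) v w →
         Der rt ((a ∈D v) ∷ R ∣ Γ ⇒ (w , A [ a / x ]) ∷ (w , ∃' x A) ∷ Δ) →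
         Der rt ((a ∈D v) ∷ R ∣ Γ ⇒ (w , ∃' x A) ∷ Δ)
  lift : ∀ {R Γ Δ w u A} →
         Der rt ((w ≼ u) ∷ R ∣ (u , A) ∷ (w , A) ∷ Γ ⇒ Δ) →
         Der rt ((w ≼ u) ∷ R ∣ (w , A) ∷ Γ ⇒ Δ)

IntQCL⊢ : Seq → Set
IntQCL⊢ = Der true

IntQCL⊢-noRefTra : Seq → Set
IntQCL⊢-noRefTra = Der false

-- A derivation of S in IntQCL is replayed, rule by rule and without (ref) or (tra), inside any
-- sequent T that simulates S up to a renaming of labels and parameters: each relational atom
-- w ≤ v of S becomes a (possibly empty) ≤-chain of T, which trivialises (ref) and (tra); each
-- domain atom of S is a domain atom of T; each antecedent formula of S occurs in T or has been
-- decomposed there by invertible left rules; each succedent formula of S occurs in T at a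
-- ≤-later world or has been decomposed by invertible right rules.  The rules of S that consult
-- a relational atom are replayed along its chain: (lift) carries formulas forward, (nd) and
-- (cd) carry domain atoms, and (id*_q), (⊃*_l), (∀*_l), (∃*_r) fire at the end of the chain.
-- Because source formulas only have to be available in T rather than matched one-to-one,
-- contraction never has to be shown admissible.

module Submission where

open import Defs
open import Data.Nat using (ℕ; suc; _≟_)
open import Data.Nat.Properties using (1+n≰n)
open import Data.Bool using (Bool)
open import Data.List using (List; []; _∷_; map; concatMap)
open import Data.List.Extrema.Nat using (max; xs≤max)
open import Data.List.Membership.Propositional using (_∈_; _∉_; lose)
open import Data.List.Membership.Propositional.Properties using (∈-++⁺ˡ; ∈-++⁺ʳ; ∈-concatMap⁺)
open import Data.List.Relation.Unary.Any using (here; there; _─_)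
open import Data.List.Relation.Unary.All as All using (All)
open import Data.List.Relation.Unary.All.Properties using (map⁺)
open import Data.List.Relation.Binary.Permutation.Propositional using (_↭_; ↭-refl; ↭-sym; ↭-trans; prep; swap)
open import Data.List.Relation.Binary.Permutation.Propositional.Properties using (∈-resp-↭)
open import Data.Product using (∃; _×_; _,_)
open import Data.Sum using (_⊎_; inj₁; inj₂; [_,_]′)
open import Data.Empty using (⊥-elim)
open import Function using (id; _∘_)
open import Relation.Binary.Construct.Closure.ReflexiveTransitive as Star using (Star; ε; _◅_; _◅◅_)
open import Relation.Nullary using (yes; no)
open import Relation.Binary.PropositionalEquality using (_≡_; _≢_; refl; sym; trans; cong; cong₂; subst; subst₂)

module _ {A : Set} where

  ─-↭ : ∀ {x : A} {xs} (p : x ∈ xs) → xs ↭ x ∷ (xs ─ p)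
  ─-↭ (here refl) = ↭-refl
  ─-↭ {x} {y ∷ _} (there p) = ↭-trans (prep y (─-↭ p)) (swap y x ↭-refl)

  ∈-─ : ∀ {x y : A} {xs} (p : x ∈ xs) → y ∈ xs → y ≡ x ⊎ y ∈ (xs ─ p)
  ∈-─ (here refl) (here q)  = inj₁ q
  ∈-─ (here refl) (there q) = inj₂ q
  ∈-─ (there p)   (here q)  = inj₂ (here q)
  ∈-─ (there p)   (there q) = [ inj₁ , inj₂ ∘ there ]′ (∈-─ p q)

  ∈-concatMap⁺′ : ∀ {B : Set} (f : A → List B) {x xs y} → x ∈ xs → y ∈ f x → y ∈ concatMap f xs
  ∈-concatMap⁺′ f x∈xs y∈fx = ∈-concatMap⁺ f (lose x∈xs y∈fx)

∈∧∉⇒≢ : ∀ {xs : List ℕ} {y v} → y ∈ xs → v ∉ xs → y ≢ v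
∈∧∉⇒≢ y∈xs v∉xs refl = v∉xs y∈xs

fresh : List ℕ → ℕ
fresh xs = suc (max 0 xs)

fresh∉ : ∀ xs → fresh xs ∉ xs
fresh∉ xs m = 1+n≰n (All.lookup (xs≤max 0 xs) m)

update : (ℕ → ℕ) → ℕ → ℕ → ℕ → ℕ
update f a b n with n ≟ a
... | yes _ = b
... | no  _ = f n

update-≡ : ∀ f a b → update f a b a ≡ b
update-≡ f a b with a ≟ a
... | yes _ = refl
... | no a≢a = ⊥-elim (a≢a refl)

update-≢ : ∀ f a b {n} → n ≢ a → update f a b n ≡ f n
update-≢ f a b {n} n≢a with n ≟ a
... | yes n≡a = ⊥-elim (n≢a n≡a)
... | no  _   = refl

renT : (ℕ → ℕ) → Term → Term
renT σ (var y) = var y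
renT σ (par b) = par (σ b)

ren : (ℕ → ℕ) → Fm → Fm
ren σ (atom p ts) = atom p (map (renT σ) ts)
ren σ ⊥'          = ⊥'
ren σ (A ∨' B)    = ren σ A ∨' ren σ B
ren σ (A ∧' B)    = ren σ A ∧' ren σ B
ren σ (A ⊃ B)     = ren σ A ⊃ ren σ B
ren σ (∀' y A)    = ∀' y (ren σ A)
ren σ (∃' y A)    = ∃' y (ren σ A)

renT-substT : ∀ σ a x t → renT σ (substT x a t) ≡ substT x (σ a) (renT σ t)
renT-substT σ a x (var y) with x ≟ y
... | yes _ = refl
... | no  _ = refl
renT-substT σ a x (par b) = refl

ren-[/] : ∀ σ a x A → ren σ (A [ a / x ]) ≡ ren σ A [ σ a / x ]
ren-[/] σ a x (atom p ts) = cong (atom p) (map-commute ts)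
  where
  map-commute : ∀ ts → map (renT σ) (map (substT x a) ts) ≡ map (substT x (σ a)) (map (renT σ) ts)
  map-commute []       = refl
  map-commute (t ∷ ts) = cong₂ _∷_ (renT-substT σ a x t) (map-commute ts)
ren-[/] σ a x ⊥'       = refl
ren-[/] σ a x (A ∨' B) = cong₂ _∨'_ (ren-[/] σ a x A) (ren-[/] σ a x B)
ren-[/] σ a x (A ∧' B) = cong₂ _∧'_ (ren-[/] σ a x A) (ren-[/] σ a x B)
ren-[/] σ a x (A ⊃ B)  = cong₂ _⊃_ (ren-[/] σ a x A) (ren-[/] σ a x B)
ren-[/] σ a x (∀' y A) with x ≟ y
... | yes _ = refl
... | no  _ = cong (∀' y) (ren-[/] σ a x A)
ren-[/] σ a x (∃' y A) with x ≟ y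
... | yes _ = refl
... | no  _ = cong (∃' y) (ren-[/] σ a x A)

ren-cong : ∀ {σ σ′ : ℕ → ℕ} C → (∀ {n} → n ∈ parsF C → σ n ≡ σ′ n) → ren σ C ≡ ren σ′ C
ren-cong {σ} {σ′} (atom p ts) h = cong (atom p) (map-cong ts h)
  where
  map-cong : ∀ ts → (∀ {n} → n ∈ concatMap parsT ts → σ n ≡ σ′ n) → map (renT σ) ts ≡ map (renT σ′) ts
  map-cong []           h = refl
  map-cong (var y ∷ ts) h = cong (var y ∷_) (map-cong ts h)
  map-cong (par b ∷ ts) h = cong₂ _∷_ (cong par (h (here refl))) (map-cong ts (h ∘ there))
ren-cong ⊥'       h = refl
ren-cong (A ∨' B) h = cong₂ _∨'_ (ren-cong A (h ∘ ∈-++⁺ˡ)) (ren-cong B (h ∘ ∈-++⁺ʳ (parsF A)))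
ren-cong (A ∧' B) h = cong₂ _∧'_ (ren-cong A (h ∘ ∈-++⁺ˡ)) (ren-cong B (h ∘ ∈-++⁺ʳ (parsF A)))
ren-cong (A ⊃ B)  h = cong₂ _⊃_ (ren-cong A (h ∘ ∈-++⁺ˡ)) (ren-cong B (h ∘ ∈-++⁺ʳ (parsF A)))
ren-cong (∀' y A) h = cong (∀' y) (ren-cong A h)
ren-cong (∃' y A) h = cong (∃' y) (ren-cong A h)

ren-id : ∀ C → ren id C ≡ C
ren-id (atom p ts) = cong (atom p) (map-id ts)
  where
  map-id : ∀ ts → map (renT id) ts ≡ ts
  map-id []           = refl
  map-id (var y ∷ ts) = cong (var y ∷_) (map-id ts)
  map-id (par b ∷ ts) = cong (par b ∷_) (map-id ts)
ren-id ⊥'       = refl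
ren-id (A ∨' B) = cong₂ _∨'_ (ren-id A) (ren-id B)
ren-id (A ∧' B) = cong₂ _∧'_ (ren-id A) (ren-id B)
ren-id (A ⊃ B)  = cong₂ _⊃_ (ren-id A) (ren-id B)
ren-id (∀' y A) = cong (∀' y) (ren-id A)
ren-id (∃' y A) = cong (∃' y) (ren-id A)

ren-patom : ∀ σ p as → ren σ (patom p as) ≡ patom p (map σ as)
ren-patom σ p as = cong (atom p) (map-par as)
  where
  map-par : ∀ as → map (renT σ) (map par as) ≡ map par (map σ as)
  map-par []       = refl
  map-par (a ∷ as) = cong (par (σ a) ∷_) (map-par as)

ren-update-[/] : ∀ σ a b x A → a ∉ parsF A → ren (update σ a b) (A [ a / x ]) ≡ ren σ A [ b / x ]
ren-update-[/] σ a b x A a∉A = trans (ren-[/] (update σ a b) a x A)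
  (cong₂ (λ B c → B [ c / x ]) (ren-cong A (λ n∈A → update-≢ σ a b (∈∧∉⇒≢ n∈A a∉A))) (update-≡ σ a b))

labels-rel : ∀ S {r y} → r ∈ Seq.rel S → y ∈ labsR r → y ∈ labels S
labels-rel (R ∣ Γ ⇒ Δ) m q = ∈-++⁺ˡ (∈-concatMap⁺′ labsR m q)

labels-ant : ∀ S {w C} → (w , C) ∈ Seq.ant S → w ∈ labels S
labels-ant (R ∣ Γ ⇒ Δ) m = ∈-++⁺ʳ (concatMap labsR R) (∈-++⁺ˡ (∈-concatMap⁺′ labsLF m (here refl)))

labels-suc : ∀ S {w C} → (w , C) ∈ Seq.suc S → w ∈ labels S
labels-suc (R ∣ Γ ⇒ Δ) m =
  ∈-++⁺ʳ (concatMap labsR R) (∈-++⁺ʳ (concatMap labsLF Γ) (∈-concatMap⁺′ labsLF m (here refl)))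

params-rel : ∀ S {a w} → (a ∈D w) ∈ Seq.rel S → a ∈ params S
params-rel (R ∣ Γ ⇒ Δ) m = ∈-++⁺ˡ (∈-concatMap⁺′ parsR m (here refl))

params-ant : ∀ S {w C n} → (w , C) ∈ Seq.ant S → n ∈ parsF C → n ∈ params S
params-ant (R ∣ Γ ⇒ Δ) m q = ∈-++⁺ʳ (concatMap parsR R) (∈-++⁺ˡ (∈-concatMap⁺′ parsLF m q))

params-suc : ∀ S {w C n} → (w , C) ∈ Seq.suc S → n ∈ parsF C → n ∈ params S
params-suc (R ∣ Γ ⇒ Δ) m q =
  ∈-++⁺ʳ (concatMap parsR R) (∈-++⁺ʳ (concatMap parsLF Γ) (∈-concatMap⁺′ parsLF m q))

Reach : List RAt → ℕ → ℕ → Set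
Reach R = Star (λ x y → (x ≼ y) ∈ R)

Path-++ : ∀ {R x y z} → Path R x y → Path R y z → Path R x z
Path-++ here      q = q
Path-++ (fwd m p) q = fwd m (Path-++ p q)
Path-++ (bwd m p) q = bwd m (Path-++ p q)

Path-sym : ∀ {R x y} → Path R x y → Path R y x
Path-sym here      = here
Path-sym (fwd m p) = Path-++ (Path-sym p) (bwd m here)
Path-sym (bwd m p) = Path-++ (Path-sym p) (fwd m here)

Path-mono : ∀ {R R′} → (∀ {r} → r ∈ R → r ∈ R′) → ∀ {x y} → Path R x y → Path R′ x y
Path-mono R⊆R′ here      = here
Path-mono R⊆R′ (fwd m p) = fwd (R⊆R′ m) (Path-mono R⊆R′ p)
Path-mono R⊆R′ (bwd m p) = bwd (R⊆R′ m) (Path-mono R⊆R′ p)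

Reach⇒Path : ∀ {R x y} → Reach R x y → Path R x y
Reach⇒Path {R} = Star.fold (Path R) fwd here

-- Rules with principal atoms and formulas anywhere in the sequent

module _ {rt : Bool} {R : List RAt} {Γ Δ : List LF} where

  private
    front₂ : ∀ {r₁ r₂} → r₁ ∈ R → r₂ ∈ R → r₂ ≢ r₁ → ∃ λ R₀ → R ↭ r₁ ∷ r₂ ∷ R₀
    front₂ m₁ m₂ r₂≢r₁ with ∈-─ m₁ m₂
    ... | inj₁ r₂≡r₁ = ⊥-elim (r₂≢r₁ r₂≡r₁)
    ... | inj₂ m₂′   = _ , ↭-trans (─-↭ m₁) (prep _ (─-↭ m₂′))

    insert₃ : ∀ {r₁ r₂ r₃ R₀} → R ↭ r₁ ∷ r₂ ∷ R₀ → r₃ ∷ R ↭ r₁ ∷ r₂ ∷ r₃ ∷ R₀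
    insert₃ {r₁} {r₂} {r₃} P = ↭-trans (prep r₃ P) (↭-trans (swap r₃ r₁ ↭-refl) (prep r₁ (swap r₃ r₂ ↭-refl)))

  nd∈ : ∀ {x z b} → (x ≼ z) ∈ R → (b ∈D x) ∈ R → Der rt ((b ∈D z) ∷ R ∣ Γ ⇒ Δ) → Der rt (R ∣ Γ ⇒ Δ)
  nd∈ q m d with front₂ q m (λ ())
  ... | _ , P = perm (↭-sym P) ↭-refl ↭-refl (nd (perm (insert₃ P) ↭-refl ↭-refl d))

  cd∈ : ∀ {x z b} → (z ≼ x) ∈ R → (b ∈D x) ∈ R → Der rt ((b ∈D z) ∷ R ∣ Γ ⇒ Δ) → Der rt (R ∣ Γ ⇒ Δ)
  cd∈ q m d with front₂ q m (λ ())
  ... | _ , P = perm (↭-sym P) ↭-refl ↭-refl (cd (perm (insert₃ P) ↭-refl ↭-refl d))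

  lift∈ : ∀ {x z C} → (x ≼ z) ∈ R → (x , C) ∈ Γ → Der rt (R ∣ (z , C) ∷ Γ ⇒ Δ) → Der rt (R ∣ Γ ⇒ Δ)
  lift∈ q m d = perm (↭-sym (─-↭ q)) (↭-sym (─-↭ m)) ↭-refl (lift (perm (─-↭ q) (prep _ (─-↭ m)) ↭-refl d))

  ∃r∈ : ∀ {z b y A} → (b ∈D z) ∈ R → (z , ∃' y A) ∈ Δ →
        Der rt (R ∣ Γ ⇒ (z , A [ b / y ]) ∷ Δ) → Der rt (R ∣ Γ ⇒ Δ)
  ∃r∈ q m d = perm (↭-sym (─-↭ q)) ↭-refl (↭-sym (─-↭ m)) (∃r (perm (─-↭ q) ↭-refl (prep _ (─-↭ m)) d))

  ∀*l∈ : ∀ {z b y A} → (b ∈D z) ∈ R → (z , ∀' y A) ∈ Γ →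
         Der rt (R ∣ (z , A [ b / y ]) ∷ Γ ⇒ Δ) → Der rt (R ∣ Γ ⇒ Δ)
  ∀*l∈ q m d = perm (↭-sym (─-↭ q)) (↭-sym (─-↭ m)) ↭-refl (∀*l here (perm (─-↭ q) (prep _ (─-↭ m)) ↭-refl d))

  ⊃*l∈ : ∀ {z A B} → (z , A ⊃ B) ∈ Γ →
         Der rt (R ∣ Γ ⇒ (z , A) ∷ Δ) → Der rt (R ∣ (z , B) ∷ Γ ⇒ Δ) → Der rt (R ∣ Γ ⇒ Δ)
  ⊃*l∈ m d₁ d₂ = perm ↭-refl (↭-sym (─-↭ m)) ↭-refl
    (⊃*l (perm ↭-refl (─-↭ m) ↭-refl d₁) (perm ↭-refl (prep _ (─-↭ m)) ↭-refl d₂))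

  ¬l∈ : ∀ {z A} → (z , ¬' A) ∈ Γ → Der rt (R ∣ Γ ⇒ (z , A) ∷ Δ) → Der rt (R ∣ Γ ⇒ Δ)
  ¬l∈ m d = perm ↭-refl (↭-sym (─-↭ m)) ↭-refl (¬l (perm ↭-refl (─-↭ m) ↭-refl d))

data Availˡ (T : Seq) : ℕ → Fm → Set where
  lit  : ∀ {x C} → (x , C) ∈ Seq.ant T → Availˡ T x C
  both : ∀ {x A B} → Availˡ T x A → Availˡ T x B → Availˡ T x (A ∧' B)
  inl  : ∀ {x A B} → Availˡ T x A → Availˡ T x (A ∨' B)
  inr  : ∀ {x A B} → Availˡ T x B → Availˡ T x (A ∨' B)
  wit  : ∀ {x y A b} → (b ∈D x) ∈ Seq.rel T → Availˡ T x (A [ b / y ]) → Availˡ T x (∃' y A)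

data Availʳ (T : Seq) : ℕ → Fm → Set where
  lit  : ∀ {x z C} → Reach (Seq.rel T) x z → (z , C) ∈ Seq.suc T → Availʳ T x C
  bot  : ∀ {x} → Availʳ T x ⊥'
  inl  : ∀ {x A B} → Availʳ T x A → Availʳ T x (A ∧' B)
  inr  : ∀ {x A B} → Availʳ T x B → Availʳ T x (A ∧' B)
  both : ∀ {x A B} → Availʳ T x A → Availʳ T x B → Availʳ T x (A ∨' B)
  imp  : ∀ {x v A B} → Reach (Seq.rel T) x v → Availˡ T v A → Availʳ T v B → Availʳ T x (A ⊃ B)
  all  : ∀ {x v y A b} → Reach (Seq.rel T) x v → (b ∈D v) ∈ Seq.rel T → Availʳ T v (A [ b / y ]) →
         Availʳ T x (∀' y A)

Availʳ-up : ∀ {T x y C} → Reach (Seq.rel T) x y → Availʳ T y C → Availʳ T x C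
Availʳ-up p (lit q m)   = lit (p ◅◅ q) m
Availʳ-up p bot         = bot
Availʳ-up p (inl r)     = inl (Availʳ-up p r)
Availʳ-up p (inr r)     = inr (Availʳ-up p r)
Availʳ-up p (both r s)  = both (Availʳ-up p r) (Availʳ-up p s)
Availʳ-up p (imp q l r) = imp (p ◅◅ q) l r
Availʳ-up p (all q m r) = all (p ◅◅ q) m r

record _⊆ₛ_ (T T′ : Seq) : Set where
  constructor mk⊆
  field
    ⊆-rel : ∀ {r} → r ∈ Seq.rel T → r ∈ Seq.rel T′
    ⊆-ant : ∀ {f} → f ∈ Seq.ant T → f ∈ Seq.ant T′
    ⊆-suc : ∀ {f} → f ∈ Seq.suc T → f ∈ Seq.suc T′
open _⊆ₛ_

record _⊑_ (T T′ : Seq) : Set where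
  constructor mk⊑
  field
    ⊑-rel : ∀ {r} → r ∈ Seq.rel T → r ∈ Seq.rel T′
    ⊑-ant : ∀ {x C} → (x , C) ∈ Seq.ant T → Availˡ T′ x C
    ⊑-suc : ∀ {x C} → (x , C) ∈ Seq.suc T → Availʳ T′ x C
open _⊑_

module _ {T T′ : Seq} (T⊑T′ : T ⊑ T′) where

  Availˡ-⊑ : ∀ {x C} → Availˡ T x C → Availˡ T′ x C
  Availˡ-⊑ (lit m)    = ⊑-ant T⊑T′ m
  Availˡ-⊑ (both a b) = both (Availˡ-⊑ a) (Availˡ-⊑ b)
  Availˡ-⊑ (inl a)    = inl (Availˡ-⊑ a)
  Availˡ-⊑ (inr b)    = inr (Availˡ-⊑ b)
  Availˡ-⊑ (wit m a)  = wit (⊑-rel T⊑T′ m) (Availˡ-⊑ a)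

  Availʳ-⊑ : ∀ {x C} → Availʳ T x C → Availʳ T′ x C
  Availʳ-⊑ (lit p m)   = Availʳ-up (Star.map (⊑-rel T⊑T′) p) (⊑-suc T⊑T′ m)
  Availʳ-⊑ bot         = bot
  Availʳ-⊑ (inl r)     = inl (Availʳ-⊑ r)
  Availʳ-⊑ (inr r)     = inr (Availʳ-⊑ r)
  Availʳ-⊑ (both r s)  = both (Availʳ-⊑ r) (Availʳ-⊑ s)
  Availʳ-⊑ (imp p l r) = imp (Star.map (⊑-rel T⊑T′) p) (Availˡ-⊑ l) (Availʳ-⊑ r)
  Availʳ-⊑ (all p m r) = all (Star.map (⊑-rel T⊑T′) p) (⊑-rel T⊑T′ m) (Availʳ-⊑ r)

⊑-refl : ∀ {T} → T ⊑ T
⊑-refl = mk⊑ id lit (lit ε)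

⊆⇒⊑ : ∀ {T T′} → T ⊆ₛ T′ → T ⊑ T′
⊆⇒⊑ i = mk⊑ (⊆-rel i) (lit ∘ ⊆-ant i) (lit ε ∘ ⊆-suc i)

⊆-refl : ∀ {T} → T ⊆ₛ T
⊆-refl = mk⊆ id id id

⊆-trans : ∀ {T₁ T₂ T₃} → T₁ ⊆ₛ T₂ → T₂ ⊆ₛ T₃ → T₁ ⊆ₛ T₃
⊆-trans i₁ i₂ = mk⊆ (⊆-rel i₂ ∘ ⊆-rel i₁) (⊆-ant i₂ ∘ ⊆-ant i₁) (⊆-suc i₂ ∘ ⊆-suc i₁)

⊢₀_ : Seq → Set
⊢₀_ = IntQCL⊢-noRefTra

-- To derive T it suffices to derive every ≺-extension of T satisfying P; the lemmas taking
-- such a continuation build the extension by rules applied bottom-up.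
Above : (Seq → Seq → Set) → Seq → (Seq → Set) → Set
Above _≺_ T P = ∀ {T′} → T ≺ T′ → P T′ → ⊢₀ T′

-- In a `lit` case the rule is applied to the formula of the target itself; whatever else
-- referred to that formula now refers to its components.

module _ {R : List RAt} {Γ Δ : List LF} where

  decompose-∧ˡ : ∀ {x A B} → Availˡ (R ∣ Γ ⇒ Δ) x (A ∧' B) →
                 Above _⊑_ (R ∣ Γ ⇒ Δ) (λ T → Availˡ T x A × Availˡ T x B) → ⊢₀ (R ∣ Γ ⇒ Δ)
  decompose-∧ˡ (both a b) k = k ⊑-refl (a , b)
  decompose-∧ˡ {x} {A} {B} (lit m) k =
    perm ↭-refl (↭-sym (─-↭ m)) ↭-refl (∧l (k (mk⊑ id antecedent (lit ε)) (lit (here refl) , lit (there (here refl)))))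
    where
    antecedent : ∀ {y D} → (y , D) ∈ Γ → Availˡ (R ∣ (x , A) ∷ (x , B) ∷ (Γ ─ m) ⇒ Δ) y D
    antecedent q with ∈-─ m q
    ... | inj₁ refl = both (lit (here refl)) (lit (there (here refl)))
    ... | inj₂ q′   = lit (there (there q′))

  decompose-∨ˡ : ∀ {x A B} → Availˡ (R ∣ Γ ⇒ Δ) x (A ∨' B) →
                 Above _⊑_ (R ∣ Γ ⇒ Δ) (λ T → Availˡ T x A ⊎ Availˡ T x B) → ⊢₀ (R ∣ Γ ⇒ Δ)
  decompose-∨ˡ (inl a) k = k ⊑-refl (inj₁ a)
  decompose-∨ˡ (inr b) k = k ⊑-refl (inj₂ b)
  decompose-∨ˡ {x} {A} {B} (lit m) k = perm ↭-refl (↭-sym (─-↭ m)) ↭-refl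
    (∨l (k (mk⊑ id (antecedent inl) (lit ε)) (inj₁ (lit (here refl))))
        (k (mk⊑ id (antecedent inr) (lit ε)) (inj₂ (lit (here refl)))))
    where
    antecedent : ∀ {E} → (∀ {T} → Availˡ T x E → Availˡ T x (A ∨' B)) →
          ∀ {y D} → (y , D) ∈ Γ → Availˡ (R ∣ (x , E) ∷ (Γ ─ m) ⇒ Δ) y D
    antecedent inj q with ∈-─ m q
    ... | inj₁ refl = inj (lit (here refl))
    ... | inj₂ q′   = lit (there q′)

  decompose-∃ˡ : ∀ {x y A} → Availˡ (R ∣ Γ ⇒ Δ) x (∃' y A) →
                 Above _⊑_ (R ∣ Γ ⇒ Δ) (λ T → ∃ λ b → (b ∈D x) ∈ Seq.rel T × Availˡ T x (A [ b / y ])) →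
                 ⊢₀ (R ∣ Γ ⇒ Δ)
  decompose-∃ˡ (wit q a) k = k ⊑-refl (_ , q , a)
  decompose-∃ˡ {x} {y} {A} (lit m) k = perm ↭-refl (↭-sym (─-↭ m)) ↭-refl
    (∃l (fresh∉ _) (k (mk⊑ there antecedent (lit ε)) (c , here refl , lit (here refl))))
    where
    c = fresh (params (R ∣ (x , ∃' y A) ∷ (Γ ─ m) ⇒ Δ))
    antecedent : ∀ {w D} → (w , D) ∈ Γ → Availˡ ((c ∈D x) ∷ R ∣ (x , A [ c / y ]) ∷ (Γ ─ m) ⇒ Δ) w D
    antecedent q with ∈-─ m q
    ... | inj₁ refl = wit (here refl) (lit (here refl))
    ... | inj₂ q′   = lit (there q′)

  decompose-∧ʳ : ∀ {x A B} → Availʳ (R ∣ Γ ⇒ Δ) x (A ∧' B) →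
                 Above _⊑_ (R ∣ Γ ⇒ Δ) (λ T → Availʳ T x A ⊎ Availʳ T x B) → ⊢₀ (R ∣ Γ ⇒ Δ)
  decompose-∧ʳ (inl a) k = k ⊑-refl (inj₁ a)
  decompose-∧ʳ (inr b) k = k ⊑-refl (inj₂ b)
  decompose-∧ʳ {x} {A} {B} (lit {z = z} p m) k = perm ↭-refl ↭-refl (↭-sym (─-↭ m))
    (∧r (k (mk⊑ id lit (succedent inl)) (inj₁ (lit p (here refl))))
        (k (mk⊑ id lit (succedent inr)) (inj₂ (lit p (here refl)))))
    where
    succedent : ∀ {E} → (∀ {T} → Availʳ T z E → Availʳ T z (A ∧' B)) →
          ∀ {y D} → (y , D) ∈ Δ → Availʳ (R ∣ Γ ⇒ (z , E) ∷ (Δ ─ m)) y D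
    succedent inj q with ∈-─ m q
    ... | inj₁ refl = inj (lit ε (here refl))
    ... | inj₂ q′   = lit ε (there q′)

  decompose-∨ʳ : ∀ {x A B} → Availʳ (R ∣ Γ ⇒ Δ) x (A ∨' B) →
                 Above _⊑_ (R ∣ Γ ⇒ Δ) (λ T → Availʳ T x A × Availʳ T x B) → ⊢₀ (R ∣ Γ ⇒ Δ)
  decompose-∨ʳ (both a b) k = k ⊑-refl (a , b)
  decompose-∨ʳ {x} {A} {B} (lit {z = z} p m) k = perm ↭-refl ↭-refl (↭-sym (─-↭ m))
    (∨r (k (mk⊑ id lit succedent) (lit p (here refl) , lit p (there (here refl)))))
    where
    succedent : ∀ {y D} → (y , D) ∈ Δ → Availʳ (R ∣ Γ ⇒ (z , A) ∷ (z , B) ∷ (Δ ─ m)) y D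
    succedent q with ∈-─ m q
    ... | inj₁ refl = both (lit ε (here refl)) (lit ε (there (here refl)))
    ... | inj₂ q′   = lit ε (there (there q′))

  decompose-⊃ʳ : ∀ {x A B} → Availʳ (R ∣ Γ ⇒ Δ) x (A ⊃ B) →
                 Above _⊑_ (R ∣ Γ ⇒ Δ) (λ T → ∃ λ v → Reach (Seq.rel T) x v × Availˡ T v A × Availʳ T v B) →
                 ⊢₀ (R ∣ Γ ⇒ Δ)
  decompose-⊃ʳ (imp p a b) k = k ⊑-refl (_ , p , a , b)
  decompose-⊃ʳ {x} {A} {B} (lit {z = z} p m) k = perm ↭-refl ↭-refl (↭-sym (─-↭ m))
    (⊃r (fresh∉ _) (k (mk⊑ there (λ q → lit (there q)) succedent)
                      (v , Star.map there p ◅◅ (here refl ◅ ε) , lit (here refl) , lit ε (here refl))))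
    where
    v = fresh (labels (R ∣ Γ ⇒ (z , A ⊃ B) ∷ (Δ ─ m)))
    succedent : ∀ {y D} → (y , D) ∈ Δ → Availʳ ((z ≼ v) ∷ R ∣ (v , A) ∷ Γ ⇒ (v , B) ∷ (Δ ─ m)) y D
    succedent q with ∈-─ m q
    ... | inj₁ refl = imp (here refl ◅ ε) (lit (here refl)) (lit ε (here refl))
    ... | inj₂ q′   = lit ε (there q′)

  decompose-∀ʳ : ∀ {x y A} → Availʳ (R ∣ Γ ⇒ Δ) x (∀' y A) →
                 Above _⊑_ (R ∣ Γ ⇒ Δ)
                   (λ T → ∃ λ v → ∃ λ b → Reach (Seq.rel T) x v × (b ∈D v) ∈ Seq.rel T × Availʳ T v (A [ b / y ])) →
                 ⊢₀ (R ∣ Γ ⇒ Δ)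
  decompose-∀ʳ (all p q r) k = k ⊑-refl (_ , _ , p , q , r)
  decompose-∀ʳ {x} {y} {A} (lit {z = z} p m) k = perm ↭-refl ↭-refl (↭-sym (─-↭ m))
    (∀r (fresh∉ _) (fresh∉ _)
      (k (mk⊑ (there ∘ there) lit succedent)
         (v , c , Star.map (there ∘ there) p ◅◅ (here refl ◅ ε) , there (here refl) , lit ε (here refl))))
    where
    v = fresh (labels (R ∣ Γ ⇒ (z , ∀' y A) ∷ (Δ ─ m)))
    c = fresh (params (R ∣ Γ ⇒ (z , ∀' y A) ∷ (Δ ─ m)))
    succedent : ∀ {w D} → (w , D) ∈ Δ → Availʳ ((z ≼ v) ∷ (c ∈D v) ∷ R ∣ Γ ⇒ (v , A [ c / y ]) ∷ (Δ ─ m)) w D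
    succedent q with ∈-─ m q
    ... | inj₁ refl = all (here refl ◅ ε) (there (here refl)) (lit ε (here refl))
    ... | inj₂ q′   = lit ε (there q′)

-- Moving domain atoms and antecedent formulas along ≤-chains

⊆-weaken-rel : ∀ {R Γ Δ r} → (R ∣ Γ ⇒ Δ) ⊆ₛ (r ∷ R ∣ Γ ⇒ Δ)
⊆-weaken-rel = mk⊆ there id id

⊆-weaken-ant : ∀ {R Γ Δ f} → (R ∣ Γ ⇒ Δ) ⊆ₛ (R ∣ f ∷ Γ ⇒ Δ)
⊆-weaken-ant = mk⊆ id there id

⊆-weaken-suc : ∀ {R Γ Δ f} → (R ∣ Γ ⇒ Δ) ⊆ₛ (R ∣ Γ ⇒ f ∷ Δ)
⊆-weaken-suc = mk⊆ id id there

domain-along : ∀ {R₀ R Γ Δ x y b} → (∀ {r} → r ∈ R₀ → r ∈ R) → Path R₀ x y → (b ∈D x) ∈ R →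
               Above _⊆ₛ_ (R ∣ Γ ⇒ Δ) (λ T → (b ∈D y) ∈ Seq.rel T) → ⊢₀ (R ∣ Γ ⇒ Δ)
domain-along R₀⊆R here      m k = k ⊆-refl m
domain-along R₀⊆R (fwd q p) m k =
  nd∈ (R₀⊆R q) m (domain-along (there ∘ R₀⊆R) p (here refl) (k ∘ ⊆-trans ⊆-weaken-rel))
domain-along R₀⊆R (bwd q p) m k =
  cd∈ (R₀⊆R q) m (domain-along (there ∘ R₀⊆R) p (here refl) (k ∘ ⊆-trans ⊆-weaken-rel))

lift-along : ∀ {R Γ Δ x y C} → Reach R x y → (x , C) ∈ Γ →
             Above _⊆ₛ_ (R ∣ Γ ⇒ Δ) (λ T → (y , C) ∈ Seq.ant T) → ⊢₀ (R ∣ Γ ⇒ Δ)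
lift-along ε       m k = k ⊆-refl m
lift-along (q ◅ p) m k = lift∈ q m (lift-along p (here refl) (k ∘ ⊆-trans ⊆-weaken-ant))

lift-all : ∀ {R Γ Δ x y} → Reach R x y → (L : List LF) → (∀ {f} → f ∈ L → f ∈ Γ) →
           Above _⊆ₛ_ (R ∣ Γ ⇒ Δ) (λ T → ∀ {D} → (x , D) ∈ L → (y , D) ∈ Seq.ant T) → ⊢₀ (R ∣ Γ ⇒ Δ)
lift-all p [] L⊆Γ k = k ⊆-refl (λ ())
lift-all {x = x} p ((w , D) ∷ L) L⊆Γ k with w ≟ x
... | yes refl = lift-along p (L⊆Γ (here refl)) λ i₁ m₁ →
      lift-all (Star.map (⊆-rel i₁) p) L (⊆-ant i₁ ∘ L⊆Γ ∘ there) λ i₂ h →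
      k (⊆-trans i₁ i₂) λ { (here refl) → ⊆-ant i₂ m₁ ; (there q) → h q }
... | no w≢x = lift-all p L (L⊆Γ ∘ there) λ i h →
      k i λ { (here refl) → ⊥-elim (w≢x refl) ; (there q) → h q }

domain-all : ∀ {R Γ Δ x y} → Path R x y → (L : List RAt) → (∀ {r} → r ∈ L → r ∈ R) →
             Above _⊆ₛ_ (R ∣ Γ ⇒ Δ) (λ T → ∀ {b} → (b ∈D x) ∈ L → (b ∈D y) ∈ Seq.rel T) → ⊢₀ (R ∣ Γ ⇒ Δ)
domain-all p [] L⊆R k = k ⊆-refl (λ ())
domain-all p ((w ≼ z) ∷ L) L⊆R k = domain-all p L (L⊆R ∘ there) λ i h →
  k i λ { (there q) → h q }
domain-all {x = x} p ((b ∈D w) ∷ L) L⊆R k with w ≟ x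
... | yes refl = domain-along id p (L⊆R (here refl)) λ i₁ m₁ →
      domain-all (Path-mono (⊆-rel i₁) p) L (⊆-rel i₁ ∘ L⊆R ∘ there) λ i₂ h →
      k (⊆-trans i₁ i₂) λ { (here refl) → ⊆-rel i₂ m₁ ; (there q) → h q }
... | no w≢x = domain-all p L (L⊆R ∘ there) λ i h →
      k i λ { (here refl) → ⊥-elim (w≢x refl) ; (there q) → h q }

Availˡ-relocate : ∀ {T T′ x y C} → Availˡ T x C →
                  (∀ {D} → (x , D) ∈ Seq.ant T → (y , D) ∈ Seq.ant T′) →
                  (∀ {b} → (b ∈D x) ∈ Seq.rel T → (b ∈D y) ∈ Seq.rel T′) → Availˡ T′ y C
Availˡ-relocate (lit m)    f g = lit (f m)
Availˡ-relocate (both a b) f g = both (Availˡ-relocate a f g) (Availˡ-relocate b f g)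
Availˡ-relocate (inl a)    f g = inl (Availˡ-relocate a f g)
Availˡ-relocate (inr b)    f g = inr (Availˡ-relocate b f g)
Availˡ-relocate (wit m a)  f g = wit (g m) (Availˡ-relocate a f g)

lift-Availˡ : ∀ {R Γ Δ x y C} → Reach R x y → Availˡ (R ∣ Γ ⇒ Δ) x C →
              Above _⊆ₛ_ (R ∣ Γ ⇒ Δ) (λ T → Availˡ T y C) → ⊢₀ (R ∣ Γ ⇒ Δ)
lift-Availˡ {R} {Γ} p a k =
  lift-all p Γ id λ i₁ lifted →
  domain-all (Reach⇒Path (Star.map (⊆-rel i₁) p)) _ id λ i₂ moved →
  k (⊆-trans i₁ i₂) (Availˡ-relocate a (⊆-ant i₂ ∘ lifted) (moved ∘ ⊆-rel i₁))

-- Simulation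

Realised : (ℕ → ℕ) → (ℕ → ℕ) → List RAt → RAt → Set
Realised σ τ R (w ≼ v)  = Reach R (τ w) (τ v)
Realised σ τ R (a ∈D w) = (σ a ∈D τ w) ∈ R

Realised-mono : ∀ {σ τ R R′} r → (∀ {r} → r ∈ R → r ∈ R′) → Realised σ τ R r → Realised σ τ R′ r
Realised-mono (w ≼ v)  R⊆R′ = Star.map R⊆R′
Realised-mono (a ∈D w) R⊆R′ = R⊆R′

Path-Realised : ∀ {σ τ R R′ v w} → (∀ {r} → r ∈ R → Realised σ τ R′ r) → Path R v w → Path R′ (τ v) (τ w)
Path-Realised f here      = here
Path-Realised f (fwd q p) = Path-++ (Reach⇒Path (f q)) (Path-Realised f p)
Path-Realised f (bwd q p) = Path-++ (Path-sym (Reach⇒Path (f q))) (Path-Realised f p)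

record Sim (σ τ : ℕ → ℕ) (S T : Seq) : Set where
  constructor mkSim
  field
    realised : ∀ {r} → r ∈ Seq.rel S → Realised σ τ (Seq.rel T) r
    availˡ : ∀ {w C} → (w , C) ∈ Seq.ant S → Availˡ T (τ w) (ren σ C)
    availʳ : ∀ {w C} → (w , C) ∈ Seq.suc S → Availʳ T (τ w) (ren σ C)
open Sim

Sim-⊑ : ∀ {σ τ S T T′} → T ⊑ T′ → Sim σ τ S T → Sim σ τ S T′
Sim-⊑ e s = mkSim (λ {r} m → Realised-mono r (⊑-rel e) (realised s m)) (Availˡ-⊑ e ∘ availˡ s) (Availʳ-⊑ e ∘ availʳ s)

Sim-⊆ : ∀ {σ τ S T T′} → T ⊆ₛ T′ → Sim σ τ S T → Sim σ τ S T′
Sim-⊆ = Sim-⊑ ∘ ⊆⇒⊑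

Sim-initial : ∀ {S} → Sim id id S S
Sim-initial {R ∣ Γ ⇒ Δ} = mkSim rel (λ {w} {C} m → lit (subst (λ D → (w , D) ∈ Γ) (sym (ren-id C)) m))
                                    (λ {w} {C} m → lit ε (subst (λ D → (w , D) ∈ Δ) (sym (ren-id C)) m))
  where
  rel : ∀ {r} → r ∈ R → Realised id id R r
  rel {w ≼ v}  m = m ◅ ε
  rel {a ∈D w} m = m

module _ {σ τ : ℕ → ℕ} {R : List RAt} {Γ Δ : List LF} {T : Seq} where

  Sim-∷-rel : ∀ {r} → Realised σ τ (Seq.rel T) r → Sim σ τ (R ∣ Γ ⇒ Δ) T → Sim σ τ (r ∷ R ∣ Γ ⇒ Δ) T
  Sim-∷-rel a s = mkSim (λ { (here refl) → a ; (there m) → realised s m }) (availˡ s) (availʳ s)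

  Sim-∷-ant : ∀ {w C} → Availˡ T (τ w) (ren σ C) → Sim σ τ (R ∣ Γ ⇒ Δ) T → Sim σ τ (R ∣ (w , C) ∷ Γ ⇒ Δ) T
  Sim-∷-ant a s = mkSim (realised s) (λ { (here refl) → a ; (there m) → availˡ s m }) (availʳ s)

  Sim-∷-suc : ∀ {w C} → Availʳ T (τ w) (ren σ C) → Sim σ τ (R ∣ Γ ⇒ Δ) T → Sim σ τ (R ∣ Γ ⇒ (w , C) ∷ Δ) T
  Sim-∷-suc a s = mkSim (realised s) (availˡ s) (λ { (here refl) → a ; (there m) → availʳ s m })

  Sim-drop-ant : ∀ {f} → Sim σ τ (R ∣ f ∷ Γ ⇒ Δ) T → Sim σ τ (R ∣ Γ ⇒ Δ) T
  Sim-drop-ant s = mkSim (realised s) (availˡ s ∘ there) (availʳ s)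

  Sim-drop-suc : ∀ {f} → Sim σ τ (R ∣ Γ ⇒ f ∷ Δ) T → Sim σ τ (R ∣ Γ ⇒ Δ) T
  Sim-drop-suc s = mkSim (realised s) (availˡ s) (availʳ s ∘ there)

  Sim-insert₃-rel : ∀ {r₁ r₂ r₃} → Realised σ τ (Seq.rel T) r₃ → Sim σ τ (r₁ ∷ r₂ ∷ R ∣ Γ ⇒ Δ) T →
                    Sim σ τ (r₁ ∷ r₂ ∷ r₃ ∷ R ∣ Γ ⇒ Δ) T
  Sim-insert₃-rel a s = mkSim
    (λ { (here refl) → realised s (here refl) ; (there (here refl)) → realised s (there (here refl))
       ; (there (there (here refl))) → a ; (there (there (there m))) → realised s (there (there m)) })
    (availˡ s) (availʳ s)

module _ {σ τ : ℕ → ℕ} {S T : Seq} where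

  Sim-relabel : ∀ {v u} → v ∉ labels S → Sim σ τ S T → Sim σ (update τ v u) S T
  Sim-relabel {v} {u} v∉S s = mkSim rel
    (λ {w} {C} m → subst (λ t → Availˡ T t (ren σ C)) (sym (unchanged (labels-ant S m))) (availˡ s m))
    (λ {w} {C} m → subst (λ t → Availʳ T t (ren σ C)) (sym (unchanged (labels-suc S m))) (availʳ s m))
    where
    unchanged : ∀ {y} → y ∈ labels S → update τ v u y ≡ τ y
    unchanged y∈S = update-≢ τ v u (∈∧∉⇒≢ y∈S v∉S)
    rel : ∀ {r} → r ∈ Seq.rel S → Realised σ (update τ v u) (Seq.rel T) r
    rel {w ≼ z} m = subst₂ (Reach (Seq.rel T)) (sym (unchanged (labels-rel S m (here refl))))
                          (sym (unchanged (labels-rel S m (there (here refl))))) (realised s m)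
    rel {a ∈D w} m =
      subst (λ t → (σ a ∈D t) ∈ Seq.rel T) (sym (unchanged (labels-rel S m (here refl)))) (realised s m)

  Sim-reparam : ∀ {a b} → a ∉ params S → Sim σ τ S T → Sim (update σ a b) τ S T
  Sim-reparam {a} {b} a∉S s = mkSim rel
    (λ {w} {C} m → subst (Availˡ T (τ w)) (sym (ren-cong C (unchanged ∘ params-ant S m))) (availˡ s m))
    (λ {w} {C} m → subst (Availʳ T (τ w)) (sym (ren-cong C (unchanged ∘ params-suc S m))) (availʳ s m))
    where
    unchanged : ∀ {n} → n ∈ params S → update σ a b n ≡ σ n
    unchanged n∈S = update-≢ σ a b (∈∧∉⇒≢ n∈S a∉S)
    rel : ∀ {r} → r ∈ Seq.rel S → Realised (update σ a b) τ (Seq.rel T) r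
    rel {w ≼ z}  m = realised s m
    rel {c ∈D w} m = subst (λ t → (t ∈D τ w) ∈ Seq.rel T) (sym (unchanged (params-rel S m))) (realised s m)

Simulable : Seq → Set
Simulable S = ∀ {σ τ T} → Sim σ τ S T → ⊢₀ T


atom-axiom : ∀ {R Γ Δ w z p as} → Reach R w z → (w , patom p as) ∈ Γ → (z , patom p as) ∈ Δ →
             All (λ a → ∃ λ u → (a ∈D u) ∈ R × Path R u w) as → ⊢₀ (R ∣ Γ ⇒ Δ)
atom-axiom w→z w∈Γ z∈Δ covered = lift-along w→z w∈Γ λ i z∈Γ′ →
  id*q (All.map (λ { (u , a∈u , u→w) → u , ⊆-rel i a∈u , Path-mono (⊆-rel i) (Path-++ u→w (Reach⇒Path w→z)) })
                covered)
       z∈Γ′ (⊆-suc i z∈Δ)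

module _ {σ τ : ℕ → ℕ} {S T : Seq} (s : Sim σ τ S T) {w p : ℕ} {as : List ℕ} where

  atom-ant : (w , patom p as) ∈ Seq.ant S → (τ w , patom p (map σ as)) ∈ Seq.ant T
  atom-ant m with subst (Availˡ T (τ w)) (ren-patom σ p as) (availˡ s m)
  ... | lit m′ = m′

  atom-suc : (w , patom p as) ∈ Seq.suc S →
             ∃ λ z → Reach (Seq.rel T) (τ w) z × (z , patom p (map σ as)) ∈ Seq.suc T
  atom-suc m with subst (Availʳ T (τ w)) (ren-patom σ p as) (availʳ s m)
  ... | lit p m′ = _ , p , m′

perm-simulable : ∀ {R R′ Γ Γ′ Δ Δ′} → R ↭ R′ → Γ ↭ Γ′ → Δ ↭ Δ′ →
                 Simulable (R ∣ Γ ⇒ Δ) → Simulable (R′ ∣ Γ′ ⇒ Δ′)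
perm-simulable pr pg pd ih s =
  ih (mkSim (realised s ∘ ∈-resp-↭ pr) (availˡ s ∘ ∈-resp-↭ pg) (availʳ s ∘ ∈-resp-↭ pd))

id-q-simulable : ∀ {R Γ Δ w v p as} → (w ≼ v) ∈ R → All (λ a → (a ∈D w) ∈ R) as →
                 (w , patom p as) ∈ Γ → (v , patom p as) ∈ Δ → Simulable (R ∣ Γ ⇒ Δ)
id-q-simulable {w = w} w≤v covered w∈Γ v∈Δ {τ = τ} s with atom-suc s v∈Δ
... | _ , v→z , z∈Δ′ = atom-axiom (realised s w≤v ◅◅ v→z) (atom-ant s w∈Γ) z∈Δ′
                         (map⁺ (All.map (λ a∈w → τ w , realised s a∈w , here) covered))

id*q-simulable : ∀ {R Γ Δ w p as} → All (λ a → ∃ λ v → (a ∈D v) ∈ R × Path R v w) as →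
                 (w , patom p as) ∈ Γ → (w , patom p as) ∈ Δ → Simulable (R ∣ Γ ⇒ Δ)
id*q-simulable covered w∈Γ w∈Δ {τ = τ} s with atom-suc s w∈Δ
... | _ , w→z , z∈Δ′ = atom-axiom w→z (atom-ant s w∈Γ) z∈Δ′
                         (map⁺ (All.map (λ { (v , a∈v , v~w) → τ v , realised s a∈v , Path-Realised (realised s) v~w })
                                        covered))

⊥l-simulable : ∀ {R Γ Δ w} → (w , ⊥') ∈ Γ → Simulable (R ∣ Γ ⇒ Δ)
⊥l-simulable w∈Γ s with availˡ s w∈Γ
... | lit m = ⊥l m

∧l-simulable : ∀ {R Γ Δ w A B} → Simulable (R ∣ (w , A) ∷ (w , B) ∷ Γ ⇒ Δ) →
               Simulable (R ∣ (w , A ∧' B) ∷ Γ ⇒ Δ)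
∧l-simulable ih s = decompose-∧ˡ (availˡ s (here refl)) λ e (a , b) →
  ih (Sim-∷-ant a (Sim-∷-ant b (Sim-drop-ant (Sim-⊑ e s))))

∨l-simulable : ∀ {R Γ Δ w A B} → Simulable (R ∣ (w , A) ∷ Γ ⇒ Δ) → Simulable (R ∣ (w , B) ∷ Γ ⇒ Δ) →
               Simulable (R ∣ (w , A ∨' B) ∷ Γ ⇒ Δ)
∨l-simulable ih₁ ih₂ s = decompose-∨ˡ (availˡ s (here refl)) λ e →
  [ (λ a → ih₁ (Sim-∷-ant a (Sim-drop-ant (Sim-⊑ e s)))) , (λ b → ih₂ (Sim-∷-ant b (Sim-drop-ant (Sim-⊑ e s)))) ]′

∧r-simulable : ∀ {R Γ Δ w A B} → Simulable (R ∣ Γ ⇒ (w , A) ∷ Δ) → Simulable (R ∣ Γ ⇒ (w , B) ∷ Δ) →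
               Simulable (R ∣ Γ ⇒ (w , A ∧' B) ∷ Δ)
∧r-simulable ih₁ ih₂ s = decompose-∧ʳ (availʳ s (here refl)) λ e →
  [ (λ a → ih₁ (Sim-∷-suc a (Sim-drop-suc (Sim-⊑ e s)))) , (λ b → ih₂ (Sim-∷-suc b (Sim-drop-suc (Sim-⊑ e s)))) ]′

∨r-simulable : ∀ {R Γ Δ w A B} → Simulable (R ∣ Γ ⇒ (w , A) ∷ (w , B) ∷ Δ) →
               Simulable (R ∣ Γ ⇒ (w , A ∨' B) ∷ Δ)
∨r-simulable ih s = decompose-∨ʳ (availʳ s (here refl)) λ e (a , b) →
  ih (Sim-∷-suc a (Sim-∷-suc b (Sim-drop-suc (Sim-⊑ e s))))

ref-simulable : ∀ {R Γ Δ w} → Simulable ((w ≼ w) ∷ R ∣ Γ ⇒ Δ) → Simulable (R ∣ Γ ⇒ Δ)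
ref-simulable ih s = ih (Sim-∷-rel ε s)

tra-simulable : ∀ {R Γ Δ w v u} → Simulable ((w ≼ u) ∷ (w ≼ v) ∷ (v ≼ u) ∷ R ∣ Γ ⇒ Δ) →
                Simulable ((w ≼ v) ∷ (v ≼ u) ∷ R ∣ Γ ⇒ Δ)
tra-simulable ih s = ih (Sim-∷-rel (realised s (here refl) ◅◅ realised s (there (here refl))) s)

nd-simulable : ∀ {R Γ Δ w v a} → Simulable ((w ≼ v) ∷ (a ∈D w) ∷ (a ∈D v) ∷ R ∣ Γ ⇒ Δ) →
               Simulable ((w ≼ v) ∷ (a ∈D w) ∷ R ∣ Γ ⇒ Δ)
nd-simulable ih s = domain-along id (Reach⇒Path (realised s (here refl))) (realised s (there (here refl))) λ i a∈v →
  ih (Sim-insert₃-rel a∈v (Sim-⊆ i s))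

cd-simulable : ∀ {R Γ Δ w v a} → Simulable ((w ≼ v) ∷ (a ∈D v) ∷ (a ∈D w) ∷ R ∣ Γ ⇒ Δ) →
               Simulable ((w ≼ v) ∷ (a ∈D v) ∷ R ∣ Γ ⇒ Δ)
cd-simulable ih s =
  domain-along id (Path-sym (Reach⇒Path (realised s (here refl)))) (realised s (there (here refl))) λ i a∈w →
  ih (Sim-insert₃-rel a∈w (Sim-⊆ i s))

lift-simulable : ∀ {R Γ Δ w u A} → Simulable ((w ≼ u) ∷ R ∣ (u , A) ∷ (w , A) ∷ Γ ⇒ Δ) →
                 Simulable ((w ≼ u) ∷ R ∣ (w , A) ∷ Γ ⇒ Δ)
lift-simulable ih s = lift-Availˡ (realised s (here refl)) (availˡ s (here refl)) λ i a →
  ih (Sim-∷-ant a (Sim-⊆ i s))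

module _ {σ τ : ℕ → ℕ} {S T : Seq} where

  implication-left : ∀ {y A B} → (τ y , ren σ A ⊃ ren σ B) ∈ Seq.ant T →
                     Simulable (Seq.rel S ∣ Seq.ant S ⇒ (y , A) ∷ Seq.suc S) →
                     Simulable (Seq.rel S ∣ (y , B) ∷ Seq.ant S ⇒ Seq.suc S) → Sim σ τ S T → ⊢₀ T
  implication-left ⊃∈Γ ih₁ ih₂ s = ⊃*l∈ ⊃∈Γ (ih₁ (Sim-∷-suc (lit ε (here refl)) (Sim-⊆ ⊆-weaken-suc s)))
                                           (ih₂ (Sim-∷-ant (lit (here refl)) (Sim-⊆ ⊆-weaken-ant s)))

  forall-left : ∀ {y a x A} → (σ a ∈D τ y) ∈ Seq.rel T → (τ y , ∀' x (ren σ A)) ∈ Seq.ant T →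
                Simulable (Seq.rel S ∣ (y , A [ a / x ]) ∷ Seq.ant S ⇒ Seq.suc S) → Sim σ τ S T → ⊢₀ T
  forall-left {a = a} {x} {A} a∈y ∀∈Γ ih s = ∀*l∈ a∈y ∀∈Γ
    (ih (Sim-∷-ant (subst (Availˡ _ _) (sym (ren-[/] σ a x A)) (lit (here refl))) (Sim-⊆ ⊆-weaken-ant s)))

  exists-right : ∀ {w z a x A} → (σ a ∈D z) ∈ Seq.rel T → Reach (Seq.rel T) (τ w) z →
                 (z , ∃' x (ren σ A)) ∈ Seq.suc T →
                 Simulable (Seq.rel S ∣ Seq.ant S ⇒ (w , A [ a / x ]) ∷ Seq.suc S) → Sim σ τ S T → ⊢₀ T
  exists-right {a = a} {x} {A} a∈z w→z ∃∈Δ ih s = ∃r∈ a∈z ∃∈Δ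
    (ih (Sim-∷-suc (subst (Availʳ _ _) (sym (ren-[/] σ a x A)) (lit w→z (here refl))) (Sim-⊆ ⊆-weaken-suc s)))

⊃l-simulable : ∀ {R Γ Δ w v A B} → Simulable ((w ≼ v) ∷ R ∣ (w , A ⊃ B) ∷ Γ ⇒ (v , A) ∷ Δ) →
               Simulable ((w ≼ v) ∷ R ∣ (v , B) ∷ (w , A ⊃ B) ∷ Γ ⇒ Δ) →
               Simulable ((w ≼ v) ∷ R ∣ (w , A ⊃ B) ∷ Γ ⇒ Δ)
⊃l-simulable ih₁ ih₂ s with availˡ s (here refl)
... | lit ⊃∈Γ = lift-along (realised s (here refl)) ⊃∈Γ λ i ⊃∈Γ′ →
  implication-left ⊃∈Γ′ ih₁ ih₂ (Sim-⊆ i s)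

⊃*l-simulable : ∀ {R Γ Δ w A B} → Simulable (R ∣ (w , A ⊃ B) ∷ Γ ⇒ (w , A) ∷ Δ) →
                Simulable (R ∣ (w , B) ∷ (w , A ⊃ B) ∷ Γ ⇒ Δ) → Simulable (R ∣ (w , A ⊃ B) ∷ Γ ⇒ Δ)
⊃*l-simulable ih₁ ih₂ s with availˡ s (here refl)
... | lit ⊃∈Γ = implication-left ⊃∈Γ ih₁ ih₂ s

¬l-simulable : ∀ {R Γ Δ w A} → Simulable (R ∣ (w , ¬' A) ∷ Γ ⇒ (w , A) ∷ Δ) →
               Simulable (R ∣ (w , ¬' A) ∷ Γ ⇒ Δ)
¬l-simulable ih s with availˡ s (here refl)
... | lit ¬∈Γ = ¬l∈ ¬∈Γ (ih (Sim-∷-suc (lit ε (here refl)) (Sim-⊆ ⊆-weaken-suc s)))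

∀l-simulable : ∀ {R Γ Δ w v a x A} →
               Simulable ((w ≼ v) ∷ (a ∈D v) ∷ R ∣ (v , A [ a / x ]) ∷ (w , ∀' x A) ∷ Γ ⇒ Δ) →
               Simulable ((w ≼ v) ∷ (a ∈D v) ∷ R ∣ (w , ∀' x A) ∷ Γ ⇒ Δ)
∀l-simulable ih s with availˡ s (here refl)
... | lit ∀∈Γ = lift-along (realised s (here refl)) ∀∈Γ λ i ∀∈Γ′ →
  forall-left (⊆-rel i (realised s (there (here refl)))) ∀∈Γ′ ih (Sim-⊆ i s)

∀*l-simulable : ∀ {R Γ Δ w v a x A} → Path ((a ∈D v) ∷ R) v w →
                Simulable ((a ∈D v) ∷ R ∣ (w , A [ a / x ]) ∷ (w , ∀' x A) ∷ Γ ⇒ Δ) →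
                Simulable ((a ∈D v) ∷ R ∣ (w , ∀' x A) ∷ Γ ⇒ Δ)
∀*l-simulable v~w ih s with availˡ s (here refl)
... | lit ∀∈Γ = domain-along id (Path-Realised (realised s) v~w) (realised s (here refl)) λ i a∈w →
  forall-left a∈w (⊆-ant i ∀∈Γ) ih (Sim-⊆ i s)

∃r-simulable : ∀ {R Γ Δ w a x A} → Simulable ((a ∈D w) ∷ R ∣ Γ ⇒ (w , A [ a / x ]) ∷ (w , ∃' x A) ∷ Δ) →
               Simulable ((a ∈D w) ∷ R ∣ Γ ⇒ (w , ∃' x A) ∷ Δ)
∃r-simulable ih s with availʳ s (here refl)
... | lit w→z ∃∈Δ = domain-along id (Reach⇒Path w→z) (realised s (here refl)) λ i a∈z →
  exists-right a∈z (Star.map (⊆-rel i) w→z) (⊆-suc i ∃∈Δ) ih (Sim-⊆ i s)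

∃*r-simulable : ∀ {R Γ Δ w v a x A} → Path ((a ∈D v) ∷ R) v w →
                Simulable ((a ∈D v) ∷ R ∣ Γ ⇒ (w , A [ a / x ]) ∷ (w , ∃' x A) ∷ Δ) →
                Simulable ((a ∈D v) ∷ R ∣ Γ ⇒ (w , ∃' x A) ∷ Δ)
∃*r-simulable v~w ih s with availʳ s (here refl)
... | lit w→z ∃∈Δ =
  domain-along id (Path-++ (Path-Realised (realised s) v~w) (Reach⇒Path w→z)) (realised s (here refl)) λ i a∈z →
  exists-right a∈z (Star.map (⊆-rel i) w→z) (⊆-suc i ∃∈Δ) ih (Sim-⊆ i s)

Reach-update : ∀ {R τ v v₀ w} → w ≢ v → Reach R (τ w) v₀ → Reach R (update τ v v₀ w) (update τ v v₀ v)
Reach-update {τ = τ} {v} {v₀} w≢v = subst₂ (Reach _) (sym (update-≢ τ v v₀ w≢v)) (sym (update-≡ τ v v₀))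

⊃r-simulable : ∀ {R Γ Δ w v A B} → v ∉ labels (R ∣ Γ ⇒ (w , A ⊃ B) ∷ Δ) →
               Simulable ((w ≼ v) ∷ R ∣ (v , A) ∷ Γ ⇒ (v , B) ∷ Δ) → Simulable (R ∣ Γ ⇒ (w , A ⊃ B) ∷ Δ)
⊃r-simulable {R} {Γ} {Δ} {w} {v} {A} {B} v∉S ih {σ} {τ} s =
  decompose-⊃ʳ (availʳ s (here refl)) λ {T} e (v₀ , w→v₀ , a , b) →
  let at-v₀ = sym (update-≡ τ v v₀) in
  ih (Sim-∷-rel (Reach-update (∈∧∉⇒≢ (labels-suc (R ∣ Γ ⇒ (w , A ⊃ B) ∷ Δ) (here refl)) v∉S) w→v₀)
     (Sim-∷-ant (subst (λ t → Availˡ T t (ren σ A)) at-v₀ a)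
     (Sim-∷-suc (subst (λ t → Availʳ T t (ren σ B)) at-v₀ b)
     (Sim-drop-suc (Sim-relabel v∉S (Sim-⊑ e s))))))

¬r-simulable : ∀ {R Γ Δ w v A} → v ∉ labels (R ∣ Γ ⇒ (w , ¬' A) ∷ Δ) →
               Simulable ((w ≼ v) ∷ R ∣ (v , A) ∷ Γ ⇒ Δ) → Simulable (R ∣ Γ ⇒ (w , ¬' A) ∷ Δ)
¬r-simulable {R} {Γ} {Δ} {w} {v} {A} v∉S ih {σ} {τ} s =
  decompose-⊃ʳ (availʳ s (here refl)) λ {T} e (v₀ , w→v₀ , a , _) →
  ih (Sim-∷-rel (Reach-update (∈∧∉⇒≢ (labels-suc (R ∣ Γ ⇒ (w , ¬' A) ∷ Δ) (here refl)) v∉S) w→v₀)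
     (Sim-∷-ant (subst (λ t → Availˡ T t (ren σ A)) (sym (update-≡ τ v v₀)) a)
     (Sim-drop-suc (Sim-relabel v∉S (Sim-⊑ e s)))))

∀r-simulable : ∀ {R Γ Δ w v a x A} →
               v ∉ labels (R ∣ Γ ⇒ (w , ∀' x A) ∷ Δ) → a ∉ params (R ∣ Γ ⇒ (w , ∀' x A) ∷ Δ) →
               Simulable ((w ≼ v) ∷ (a ∈D v) ∷ R ∣ Γ ⇒ (v , A [ a / x ]) ∷ Δ) →
               Simulable (R ∣ Γ ⇒ (w , ∀' x A) ∷ Δ)
∀r-simulable {R} {Γ} {Δ} {w} {v} {a} {x} {A} v∉S a∉S ih {σ} {τ} s =
  decompose-∀ʳ (availʳ s (here refl)) λ {T} e (v₀ , b , w→v₀ , b∈v₀ , r) →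
  let at-v₀ = sym (update-≡ τ v v₀) in
  ih (Sim-∷-rel (Reach-update (∈∧∉⇒≢ (labels-suc S (here refl)) v∉S) w→v₀)
     (Sim-∷-rel (subst₂ (λ c t → (c ∈D t) ∈ Seq.rel T) (sym (update-≡ σ a b)) at-v₀ b∈v₀)
     (Sim-∷-suc (subst₂ (Availʳ T) at-v₀ (sym (ren-update-[/] σ a b x A (a∉S ∘ params-suc S (here refl)))) r)
     (Sim-drop-suc (Sim-reparam a∉S (Sim-relabel v∉S (Sim-⊑ e s)))))))
  where S = R ∣ Γ ⇒ (w , ∀' x A) ∷ Δ

∀*r-simulable : ∀ {R Γ Δ w a x A} → a ∉ params (R ∣ Γ ⇒ (w , ∀' x A) ∷ Δ) →
                Simulable ((a ∈D w) ∷ R ∣ Γ ⇒ (w , A [ a / x ]) ∷ Δ) → Simulable (R ∣ Γ ⇒ (w , ∀' x A) ∷ Δ)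
∀*r-simulable {R} {Γ} {Δ} {w} {a} {x} {A} a∉S ih {σ} {τ} s =
  decompose-∀ʳ (availʳ s (here refl)) λ e (v₀ , b , w→v₀ , b∈v₀ , r) →
  domain-along id (Path-sym (Reach⇒Path w→v₀)) b∈v₀ λ {T} i b∈w →
  ih (Sim-∷-rel (subst (λ c → (c ∈D τ w) ∈ Seq.rel T) (sym (update-≡ σ a b)) b∈w)
     (Sim-∷-suc (subst (Availʳ T (τ w)) (sym (ren-update-[/] σ a b x A (a∉S ∘ params-suc S (here refl))))
                       (Availʳ-up (Star.map (⊆-rel i) w→v₀) (Availʳ-⊑ (⊆⇒⊑ i) r)))
     (Sim-drop-suc (Sim-reparam a∉S (Sim-⊆ i (Sim-⊑ e s))))))
  where S = R ∣ Γ ⇒ (w , ∀' x A) ∷ Δ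

∃l-simulable : ∀ {R Γ Δ w a x A} → a ∉ params (R ∣ (w , ∃' x A) ∷ Γ ⇒ Δ) →
               Simulable ((a ∈D w) ∷ R ∣ (w , A [ a / x ]) ∷ Γ ⇒ Δ) → Simulable (R ∣ (w , ∃' x A) ∷ Γ ⇒ Δ)
∃l-simulable {R} {Γ} {Δ} {w} {a} {x} {A} a∉S ih {σ} {τ} s =
  decompose-∃ˡ (availˡ s (here refl)) λ {T} e (b , b∈w , r) →
  ih (Sim-∷-rel (subst (λ c → (c ∈D τ w) ∈ Seq.rel T) (sym (update-≡ σ a b)) b∈w)
     (Sim-∷-ant (subst (Availˡ T (τ w)) (sym (ren-update-[/] σ a b x A (a∉S ∘ params-ant S (here refl)))) r)
     (Sim-drop-ant (Sim-reparam a∉S (Sim-⊑ e s)))))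
  where S = R ∣ (w , ∃' x A) ∷ Γ ⇒ Δ

simulable : ∀ {S} → IntQCL⊢ S → Simulable S
simulable (perm pr pg pd d)        = perm-simulable pr pg pd (simulable d)
simulable (id-q w≤v cov w∈Γ v∈Δ)   = id-q-simulable w≤v cov w∈Γ v∈Δ
simulable (⊥l w∈Γ)                 = ⊥l-simulable w∈Γ
simulable (∧l d)                   = ∧l-simulable (simulable d)
simulable (∧r d₁ d₂)               = ∧r-simulable (simulable d₁) (simulable d₂)
simulable (∨l d₁ d₂)               = ∨l-simulable (simulable d₁) (simulable d₂)
simulable (∨r d)                   = ∨r-simulable (simulable d)
simulable (⊃r v∉S d)               = ⊃r-simulable v∉S (simulable d)
simulable (⊃l d₁ d₂)               = ⊃l-simulable (simulable d₁) (simulable d₂)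
simulable (ref _ d)                = ref-simulable (simulable d)
simulable (tra _ d)                = tra-simulable (simulable d)
simulable (∀r v∉S a∉S d)           = ∀r-simulable v∉S a∉S (simulable d)
simulable (∃r d)                   = ∃r-simulable (simulable d)
simulable (∃l a∉S d)               = ∃l-simulable a∉S (simulable d)
simulable (∀l d)                   = ∀l-simulable (simulable d)
simulable (nd d)                   = nd-simulable (simulable d)
simulable (cd d)                   = cd-simulable (simulable d)
simulable (id*q cov w∈Γ w∈Δ)       = id*q-simulable cov w∈Γ w∈Δ
simulable (¬r v∉S d)               = ¬r-simulable v∉S (simulable d)
simulable (¬l d)                   = ¬l-simulable (simulable d)
simulable (⊃*l d₁ d₂)              = ⊃*l-simulable (simulable d₁) (simulable d₂)
simulable (∀*r a∉S d)              = ∀*r-simulable a∉S (simulable d)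
simulable (∀*l v~w d)              = ∀*l-simulable v~w (simulable d)
simulable (∃*r v~w d)              = ∃*r-simulable v~w (simulable d)
simulable (lift d)                 = lift-simulable (simulable d)

lemma7 : (s : Seq) → IntQCL⊢ s → IntQCL⊢-noRefTra s
lemma7 s d = simulable d Sim-initial
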